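{- Let $T$ be a finite tree with vertex set $V$ and a distinguished root $r$. Let $\mathcal{F}$ be the family consisting of the empty set together with all vertex sets $U\subseteq V$ such that $U$ induces a subtree of $T$ and $r\in U$. For $A\subseteq V$ define \[ \sigma(A)=\bigcap\{X : A\subseteq X\subseteq V,\ V\setminus X\in\mathcal{F}\}, \] and call $A$ closed if $\sigma(A)=A$. Then every closed set $A$ is a union of $k$ pairwise disjoint maximal subtrees $T_1,\dots,T_k\subseteq T$ with set of roots $H=\{e_1,\dots,e_k\}$, where $e_i\in T_i$ is the vertex of $T_i$ of smallest height (closest to $r$) and $T_i$ consists of $e_i$ together with all of its descendants in $T$.
   Context: The height $h(v)$ of a vertex $v$ is its distance from the root $r$ (so $h(r)=0$); the descendants of a vertex $v$ are the vertices $u$ whose path to $r$ passes through $v$. The pair $(V,\mathcal{F})$ is a greedoid (an antimatroid) and $\sigma$ is its closure operator. -}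

module Defs where

open import Data.Nat using (ℕ; zero; suc)
open import Data.Fin using (Fin)
open import Data.Fin.Subset using (Subset; _∈_; _∉_; _⊆_; ∁; ⊥)
open import Data.Product using (Σ; ∃; _×_; _,_)
open import Data.Sum using (_⊎_)
open import Relation.Nullary using (¬_)
open import Relation.Binary.PropositionalEquality using (_≡_; _≢_)
open import Function.Bundles using (_⇔_)

iter : ∀ {A : Set} → (A → A) → ℕ → A → A
iter f zero    x = x
iter f (suc k) x = f (iter f k x)

-- The edges of the tree are {v, parent v}
-- for v ≠ root.
record RootedTree (n : ℕ) : Set where
  field
    root     : Fin n
    parent   : Fin n → Fin n
    parent-root : parent root ≡ root
    reaches-root : ∀ v → ∃ λ k → iter parent k v ≡ root

module _ {n : ℕ} (T : RootedTree n) where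
  open RootedTree T

  Adj : Fin n → Fin n → Set
  Adj u v = (u ≢ root × parent u ≡ v) ⊎ (v ≢ root × parent v ≡ u)

  data PathIn (U : Subset n) : Fin n → Fin n → Set where
    here : ∀ {u} → u ∈ U → PathIn U u u
    step : ∀ {u w v} → u ∈ U → Adj u w → PathIn U w v → PathIn U u v

  -- U induces a connected subgraph (i.e., a subtree, as T is a tree)
  InducesSubtree : Subset n → Set
  InducesSubtree U = ∀ {u v} → u ∈ U → v ∈ U → PathIn U u v

  InF : Subset n → Set
  InF U = (U ≡ ⊥) ⊎ (root ∈ U × InducesSubtree U)

  InSigma : Subset n → Fin n → Set
  InSigma A x = ∀ (X : Subset n) → A ⊆ X → InF (∁ X) → x ∈ X

  Closed : Subset n → Set
  Closed A = ∀ x → (InSigma A x ⇔ x ∈ A)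

  DescOf : Fin n → Fin n → Set
  DescOf v u = ∃ λ m → iter parent m u ≡ v

-- If parent x lies in A, then x ∈ σ(A): a rooted subtree containing x but not
-- parent x would have to leave the subtree below x elsewhere than through
-- parent x, which is impossible in a tree.  So a closed set is closed under
-- children, hence under descendants.  Its roots e_i are the members of A that
-- are r or whose parent is outside A.  Walking up from any u ∈ A reaches such
-- a root, and two of them above a common vertex are comparable, so the
-- parent of the lower one lies below the upper one, hence in A; they coincide.
module Submission where

open import Defs
open import Data.Nat using (ℕ; zero; suc)
open import Data.Fin using (Fin; _≟_) renaming (zero to fzero; suc to fsuc)
open import Data.Fin.Subset using (Subset; _∈_; _∉_)
open import Data.Fin.Subset.Properties using (_∈?_; x∈∁p⇒x∉p; x∉p⇒x∈∁p; ∉⊥)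
open import Data.Product using (Σ; ∃; _×_; _,_; proj₁; proj₂)
open import Data.Sum using (_⊎_; inj₁; inj₂)
import Data.Empty
open import Relation.Nullary using (¬_; Dec; yes; no)
open import Relation.Nullary.Decidable using (_×-dec_; _⊎-dec_; ¬?)
open import Relation.Binary.PropositionalEquality
  using (_≡_; _≢_; refl; sym; trans; cong; subst)
open import Function.Bundles using (_⇔_; mk⇔; Equivalence)
open import Data.List using (List; _∷_; filter; lookup; length; allFin)
open import Data.List.Relation.Unary.AllPairs using (_∷_)
import Data.List.Relation.Unary.All as All
open import Data.List.Relation.Unary.Any using (index)
open import Data.List.Relation.Unary.Any.Properties using (lookup-index)
open import Data.List.Relation.Unary.Unique.Propositional using (Unique)
import Data.List.Relation.Unary.Unique.Propositional.Properties as Unique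
open import Data.List.Membership.Propositional.Properties
  using (∈-filter⁺; ∈-filter⁻; ∈-allFin; ∈-lookup)

iter-suc′ : ∀ {X : Set} (f : X → X) m x → iter f (suc m) x ≡ iter f m (f x)
iter-suc′ f zero    x = refl
iter-suc′ f (suc m) x = cong f (iter-suc′ f m x)

iter-fixed : ∀ {X : Set} (f : X → X) {x} → f x ≡ x → ∀ m → iter f m x ≡ x
iter-fixed f fx≡x zero    = refl
iter-fixed f fx≡x (suc m) = trans (cong f (iter-fixed f fx≡x m)) fx≡x

Unique⇒lookup-injective : ∀ {X : Set} {xs : List X} → Unique xs →
                          ∀ i j → lookup xs i ≡ lookup xs j → i ≡ j
Unique⇒lookup-injective (_ ∷ _)      fzero    fzero    _ = refl
Unique⇒lookup-injective (x∉xs ∷ _)   fzero    (fsuc j) e =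
  Data.Empty.⊥-elim (All.lookup x∉xs (∈-lookup j) e)
Unique⇒lookup-injective (x∉xs ∷ _)   (fsuc i) fzero    e =
  Data.Empty.⊥-elim (All.lookup x∉xs (∈-lookup i) (sym e))
Unique⇒lookup-injective (_ ∷ uniq)   (fsuc i) (fsuc j) e =
  cong fsuc (Unique⇒lookup-injective uniq i j e)

module _ {n : ℕ} (T : RootedTree n) where
  open RootedTree T

  DescOf-parent : ∀ {v u} → DescOf T v (parent u) → DescOf T v u
  DescOf-parent {u = u} (m , d) = suc m , trans (iter-suc′ parent m u) d

  DescOf-root⇒≡ : ∀ {x} → DescOf T x root → x ≡ root
  DescOf-root⇒≡ (m , d) = trans (sym d) (iter-fixed parent parent-root m)

  ancestors-comparable : ∀ {a b} u m₁ m₂ → iter parent m₁ u ≡ a → iter parent m₂ u ≡ b →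
                         DescOf T b a ⊎ DescOf T a b
  ancestors-comparable u zero     m₂   refl q    = inj₁ (m₂ , q)
  ancestors-comparable u (suc m₁) zero p    refl = inj₂ (suc m₁ , p)
  ancestors-comparable u (suc m₁) (suc m₂) p q   =
    ancestors-comparable (parent u) m₁ m₂
      (trans (sym (iter-suc′ parent m₁ u)) p) (trans (sym (iter-suc′ parent m₂ u)) q)

  pathIn-start : ∀ {U u v} → PathIn T U u v → u ∈ U
  pathIn-start (here u∈U)     = u∈U
  pathIn-start (step u∈U _ _) = u∈U

  -- Every edge leaving the set of descendants of x is the edge {x, parent x}.
  pathIn-leaving-desc⇒parent∈ : ∀ {U x u v} → PathIn T U u v →
                                DescOf T x u → ¬ DescOf T x v → parent x ∈ U
  pathIn-leaving-desc⇒parent∈ (here _) d ¬d = Data.Empty.⊥-elim (¬d d)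
  pathIn-leaving-desc⇒parent∈ (step _ (inj₁ (_ , refl)) p) (zero , refl) _ =
    pathIn-start p
  pathIn-leaving-desc⇒parent∈ (step {u = u} _ (inj₁ (_ , refl)) p) (suc m , d) ¬d =
    pathIn-leaving-desc⇒parent∈ p (m , trans (sym (iter-suc′ parent m u)) d) ¬d
  pathIn-leaving-desc⇒parent∈ (step _ (inj₂ (_ , refl)) p) d ¬d =
    pathIn-leaving-desc⇒parent∈ p (DescOf-parent d) ¬d

  parent∈⇒∈σ : ∀ {A x} → parent x ∈ A → InSigma T A x
  parent∈⇒∈σ {A} {x} px∈A X A⊆X ∁X∈𝓕 with x ∈? X
  ... | yes x∈X = x∈X
  ... | no  x∉X with ∁X∈𝓕
  ...   | inj₁ ∁X≡⊥ = Data.Empty.⊥-elim (∉⊥ (subst (x ∈_) ∁X≡⊥ (x∉p⇒x∈∁p x∉X)))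
  ...   | inj₂ (r∈∁X , connected) =
    Data.Empty.⊥-elim
      (x∈∁p⇒x∉p (pathIn-leaving-desc⇒parent∈ path (zero , refl) ¬root-desc) (A⊆X px∈A))
    where
    path = connected (x∉p⇒x∈∁p x∉X) r∈∁X
    ¬root-desc : ¬ DescOf T x root
    ¬root-desc d = x∉X (subst (_∈ X) px≡x (A⊆X px∈A))
      where
      px≡x : parent x ≡ x
      px≡x = trans (cong parent (DescOf-root⇒≡ d)) (trans parent-root (sym (DescOf-root⇒≡ d)))

  ChildClosed : Subset n → Set
  ChildClosed A = ∀ x → parent x ∈ A → x ∈ A

  Closed⇒ChildClosed : ∀ {A} → Closed T A → ChildClosed A
  Closed⇒ChildClosed cl x px∈A = Equivalence.to (cl x) (parent∈⇒∈σ px∈A)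

  ChildClosed⇒ancestor∈⇒∈ : ∀ {A} → ChildClosed A → ∀ m u → iter parent m u ∈ A → u ∈ A
  ChildClosed⇒ancestor∈⇒∈ cc zero    u u∈A = u∈A
  ChildClosed⇒ancestor∈⇒∈ {A} cc (suc m) u a∈A =
    cc u (ChildClosed⇒ancestor∈⇒∈ cc m (parent u) (subst (_∈ A) (iter-suc′ parent m u) a∈A))

  ChildClosed⇒desc∈ : ∀ {A v u} → ChildClosed A → v ∈ A → DescOf T v u → u ∈ A
  ChildClosed⇒desc∈ {A} {u = u} cc v∈A (m , d) =
    ChildClosed⇒ancestor∈⇒∈ cc m u (subst (_∈ A) (sym d) v∈A)

  module _ (A : Subset n) where

    IsHead : Fin n → Set
    IsHead v = v ∈ A × (v ≡ root ⊎ parent v ∉ A)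

    isHead? : ∀ v → Dec (IsHead v)
    isHead? v = (v ∈? A) ×-dec ((v ≟ root) ⊎-dec ¬? (parent v ∈? A))

    heads : List (Fin n)
    heads = filter isHead? (allFin n)

    heads-unique : Unique heads
    heads-unique = Unique.filter⁺ isHead? (Unique.allFin⁺ n)

    head : Fin (length heads) → Fin n
    head = lookup heads

    head-IsHead : ∀ i → IsHead (head i)
    head-IsHead i = proj₂ (∈-filter⁻ isHead? {xs = allFin n} (∈-lookup {xs = heads} i))

    IsHead⇒index : ∀ {h} → IsHead h → ∃ λ i → head i ≡ h
    IsHead⇒index h-head = index mem , sym (lookup-index mem)
      where mem = ∈-filter⁺ isHead? (∈-allFin _) h-head

    ∈⇒below-head : ∀ {u} k → iter parent k u ≡ root → u ∈ A →
                   ∃ λ h → IsHead h × DescOf T h u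
    ∈⇒below-head {u} k reach u∈A with u ≟ root | parent u ∈? A
    ... | yes u≡r | _       = u , (u∈A , inj₁ u≡r) , (zero , refl)
    ... | no  _   | no pu∉A = u , (u∈A , inj₂ pu∉A) , (zero , refl)
    ... | no  u≢r | yes pu∈A with k
    ...   | zero  = Data.Empty.⊥-elim (u≢r reach)
    ...   | suc k with ∈⇒below-head k (trans (sym (iter-suc′ parent k u)) reach) pu∈A
    ...     | h , h-head , d = h , h-head , DescOf-parent d

    head-below-member⇒≡ : ChildClosed A → ∀ {a b} → IsHead a → b ∈ A → DescOf T b a → a ≡ b
    head-below-member⇒≡ cc _ _ (zero , refl) = refl
    head-below-member⇒≡ cc (_ , inj₁ refl) _ (suc d , eq) =
      trans (sym (iter-fixed parent parent-root (suc d))) eq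
    head-below-member⇒≡ cc {a} (_ , inj₂ pa∉A) b∈A (suc d , eq) =
      Data.Empty.⊥-elim (pa∉A (ChildClosed⇒desc∈ cc b∈A (d , trans (sym (iter-suc′ parent d a)) eq)))

    heads-above-common⇒≡ : ChildClosed A → ∀ {a b u} → IsHead a → IsHead b →
                           DescOf T a u → DescOf T b u → a ≡ b
    heads-above-common⇒≡ cc a-head b-head (m₁ , p) (m₂ , q)
      with ancestors-comparable _ m₁ m₂ p q
    ... | inj₁ a-below-b = head-below-member⇒≡ cc a-head (proj₁ b-head) a-below-b
    ... | inj₂ b-below-a = sym (head-below-member⇒≡ cc b-head (proj₁ a-head) b-below-a)

mainTheorem2 : ∀ {n : ℕ} (T : RootedTree n) (A : Subset n) → Closed T A →
    ∃ λ (k : ℕ) → Σ (Fin k → Fin n) λ e →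
    (∀ u → (u ∈ A ⇔ (∃ λ i → DescOf T (e i) u)))
    × (∀ i j u → i ≢ j → DescOf T (e i) u → DescOf T (e j) u → Data.Empty.⊥)
    × (∀ i → (e i ≡ RootedTree.root T) ⊎ (RootedTree.parent T (e i) ∉ A))
mainTheorem2 T A cl = length (heads T A) , head T A , cover , disjoint , maximal
  where
  open RootedTree T
  cc = Closed⇒ChildClosed T cl

  cover : ∀ u → (u ∈ A ⇔ (∃ λ i → DescOf T (head T A i) u))
  cover u = mk⇔ to from
    where
    to : u ∈ A → ∃ λ i → DescOf T (head T A i) u
    to u∈A with ∈⇒below-head T A (proj₁ (reaches-root u)) (proj₂ (reaches-root u)) u∈A
    ... | h , h-head , d with IsHead⇒index T A h-head
    ...   | i , refl = i , d
    from : (∃ λ i → DescOf T (head T A i) u) → u ∈ A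
    from (i , d) = ChildClosed⇒desc∈ T cc (proj₁ (head-IsHead T A i)) d

  disjoint : ∀ i j u → i ≢ j → DescOf T (head T A i) u → DescOf T (head T A j) u → Data.Empty.⊥
  disjoint i j u i≢j dᵢ dⱼ = i≢j (Unique⇒lookup-injective (heads-unique T A) i j
    (heads-above-common⇒≡ T A cc (head-IsHead T A i) (head-IsHead T A j) dᵢ dⱼ))

  maximal : ∀ i → (head T A i ≡ root) ⊎ (parent (head T A i) ∉ A)
  maximal i = proj₂ (head-IsHead T A i)
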